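{- Let $G$ be a context-free grammar with ownership, $A$ a nondeterministic finite automaton over its terminals, $\sigma$ the least solution of the induced system of equations (in CNF), $\alpha$ a sentential form, and $c$ a choice function on $\sigma(\alpha)$. Then there is a strategy $s_{\alpha,c}$ for refuter such that every maximal play starting in $\alpha$ that conforms to $s_{\alpha,c}$ ends in a terminal word $w$ with $[w]\in\{c(K):K\in\sigma(\alpha)\}$.
   Context: Game: $G=(N_{\bigcirc}\,\dot\cup\,N_{\square},T,P)$ with disjoint finite sets of non-terminals $N=N_\bigcirc\cup N_\square$ (owned by refuter and prover, respectively) and terminals $T$, finitely many rules $X\to\eta$, every non-terminal having a rule. Left derivation: $wX\gamma\Rightarrow_L w\eta\gamma$ for $w\in T^*$ and a rule $X\to\eta$. A sentential form is owned by prover if its leftmost non-terminal is in $N_\square$, else by refuter. A play is a finite or infinite $\Rightarrow_L$-path; it is maximal if infinite or ending in a terminal word. A refuter strategy maps non-maximal finite plays ending in a refuter-owned position to a $\Rightarrow_L$-successor; a play conforms to it if all moves at refuter positions follow it. Domain: $A=(T,Q,q_0,Q_F,\to)$. Boxes are subsets of $Q\times Q$ with $\rho;\tau=\{(q,q''):\exists q'.(q,q')\in\rho,(q',q'')\in\tau\}$, $\mathrm{id}=\{(q,q)\}$, $[w]=\{(q,q'):q\xrightarrow{w}q'\}$ for $w\in T^*$. Formulas are CNF formulas (finite sets of clauses, each a finite set of boxes; $\mathit{false}=\{\{\}\}$) with $F\wedge G=F\cup G$, $F\vee G=\{K\cup H:K\in F,H\in G\}$, $F;G=\bigcup_{K\in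 F}\bigcup_{z:K\to G}\{\bigcup_{\rho\in K}\{\rho;\tau:\tau\in z(\rho)\}\}$. The Kleene iteration $\sigma^0(X)=\mathit{false}$, $\sigma^{i+1}(X)=\bigwedge_j\sigma^i(\eta_j)$ if $X\in N_\square$ and $\bigvee_j\sigma^i(\eta_j)$ if $X\in N_\bigcirc$ (over all rules $X\to\eta_j$), with $\sigma^i(\varepsilon)=\{\{\mathrm{id}\}\}$, $\sigma^i(a)=\{\{[a]\}\}$, $\sigma^i(\alpha\beta)=\sigma^i(\alpha);\sigma^i(\beta)$, stabilizes up to logical equivalence at some $i_0$; $\sigma=\sigma^{i_0}$ is the least solution, and $\sigma(\alpha)$ for a sentential form is computed by the same composition rules. A choice function on a CNF formula $F$ is a map $c$ with $c(K)\in K$ for all clauses $K\in F$. -}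

module Defs where

open import Data.Nat using (ℕ; zero; suc; _<_; _≤_)
open import Data.Fin using (Fin; _≟_)
open import Data.Bool using (Bool; true; false; _∧_; _∨_)
import Data.Bool as B
open import Data.List using (List; []; _∷_; _++_; map; concatMap; concat; zipWith; length; filter; foldr; allFin; deduplicate; applyUpTo; [_]; _∷ʳ_)
open import Data.Bool.ListAction using (any)
open import Data.List.Membership.Propositional using (_∈_)
open import Data.List.Relation.Unary.All using (All)
open import Data.List.Relation.Unary.Any using (Any)
open import Data.Vec using (Vec; tabulate; lookup)
import Data.Vec.Properties as VP
open import Data.Product using (Σ; ∃; ∃-syntax; _×_; _,_; proj₁; proj₂)
open import Data.Unit using (⊤)
open import Data.Empty using (⊥)
open import Relation.Binary.PropositionalEquality using (_≡_)
open import Relation.Nullary.Decidable using (⌊_⌋)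
open import Relation.Binary using (DecidableEquality)
open import Function.Bundles using (_⇔_)

data Owner : Set where
  refuter prover : Owner

data Sym (nN nT : ℕ) : Set where
  term : Fin nT → Sym nN nT
  nt   : Fin nN → Sym nN nT

SF : ℕ → ℕ → Set
SF nN nT = List (Sym nN nT)

record Game (nN nT : ℕ) : Set where
  field
    owner : Fin nN → Owner
    rules : List (Fin nN × SF nN nT)

EveryNTHasRule : ∀ {nN nT} → Game nN nT → Set
EveryNTHasRule {nN} {nT} G = ∀ (X : Fin nN) → ∃[ η ] ((X , η) ∈ Game.rules G)

module _ {nN nT : ℕ} (G : Game nN nT) where
  open Game G

  terms : List (Fin nT) → SF nN nT
  terms = map term

  data _⇒L_ : SF nN nT → SF nN nT → Set where
    step : ∀ (w : List (Fin nT)) (X : Fin nN) (η γ : SF nN nT) →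
           (X , η) ∈ rules →
           (terms w ++ nt X ∷ γ) ⇒L (terms w ++ η ++ γ)

  RefPos : SF nN nT → Set
  RefPos β = ∃[ w ] ∃[ X ] ∃[ γ ] (β ≡ terms w ++ nt X ∷ γ × owner X ≡ refuter)

  Path : List (SF nN nT) → Set
  Path []           = ⊤
  Path (x ∷ [])     = ⊤
  Path (x ∷ y ∷ xs) = (x ⇒L y) × Path (y ∷ xs)

  record Strategy : Set where
    field
      move  : List (SF nN nT) → SF nN nT → SF nN nT
      valid : ∀ hs β → Path (hs ∷ʳ β) → RefPos β → β ⇒L move hs β
  open Strategy public

  -- plays are given as sequences f : ℕ → SF (for a finite play of length n
  -- only f 0 … f n matter); the history before position i is  f 0 … f (i-1)
  ConformsAt : Strategy → (ℕ → SF nN nT) → ℕ → Set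
  ConformsAt s f i = RefPos (f i) → f (suc i) ≡ move s (applyUpTo f i) (f i)

record NFA (nT : ℕ) : Set where
  field
    nQ    : ℕ
    q₀    : Fin nQ
    final : Fin nQ → Bool
    trans : Fin nQ → Fin nT → Fin nQ → Bool

-- a box ⊆ Q × Q, as a Boolean matrix (so ≡ is set equality)
Box : ℕ → Set
Box n = Vec (Vec Bool n) n

_∋⟨_,_⟩ : ∀ {n} → Box n → Fin n → Fin n → Bool
ρ ∋⟨ q , q' ⟩ = lookup (lookup ρ q) q'

_≟B_ : ∀ {n} → DecidableEquality (Box n)
_≟B_ = VP.≡-dec (VP.≡-dec B._≟_)

existsFin : ∀ {n} → (Fin n → Bool) → Bool
existsFin {n} p = any p (allFin n)

_⨾_ : ∀ {n} → Box n → Box n → Box n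
ρ ⨾ τ = tabulate λ q → tabulate λ q'' → existsFin λ q' → (ρ ∋⟨ q , q' ⟩) ∧ (τ ∋⟨ q' , q'' ⟩)

idB : ∀ {n} → Box n
idB = tabulate λ q → tabulate λ q' → ⌊ q ≟ q' ⌋

module _ {nT : ℕ} (A : NFA nT) where
  open NFA A

  reach : Fin nQ → List (Fin nT) → Fin nQ → Bool
  reach q []      q' = ⌊ q ≟ q' ⌋
  reach q (a ∷ w) q' = existsFin λ q₁ → trans q a q₁ ∧ reach q₁ w q'

  ⟦_⟧ : List (Fin nT) → Box nQ
  ⟦ w ⟧ = tabulate λ q → tabulate λ q' → reach q w q'

Clause : ℕ → Set
Clause n = List (Box n)

Formula : ℕ → Set
Formula n = List (Clause n)

module _ {n : ℕ} where

  ff : Formula n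
  ff = [ [] ]

  tt : Formula n
  tt = []

  _∧F_ : Formula n → Formula n → Formula n
  F ∧F G = F ++ G

  _∨F_ : Formula n → Formula n → Formula n
  F ∨F G = concatMap (λ K → map (λ H → K ++ H) G) F

  -- all lists of length k of clauses of G  (= all maps from k positions to G)
  selections : ℕ → Formula n → List (List (Clause n))
  selections zero    G = [ [] ]
  selections (suc k) G = concatMap (λ H → map (H ∷_) (selections k G)) G

  -- F ; G : for K ∈ F and z : K → G, the clause {ρ;τ | ρ ∈ K, τ ∈ z(ρ)}.
  -- K is deduplicated so that z ranges exactly over maps from the set K.
  _⨾F_ : Formula n → Formula n → Formula n
  F ⨾F G = concatMap compK F
    where
    compK : Clause n → Formula n
    compK K = map (λ zs → concat (zipWith (λ ρ H → map (ρ ⨾_) H) K' zs))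
                 (selections (length K') G)
      where K' = deduplicate _≟B_ K

  ⋀ ⋁ : List (Formula n) → Formula n
  ⋀ = foldr _∧F_ tt
  ⋁ = foldr _∨F_ ff

  Sat : (Box n → Bool) → Formula n → Set
  Sat v F = All (λ K → Any (λ ρ → v ρ ≡ true) K) F

  _⟺_ : Formula n → Formula n → Set
  F ⟺ G = ∀ (v : Box n → Bool) → Sat v F ⇔ Sat v G

  IsChoice : (Clause n → Box n) → Formula n → Set
  IsChoice c F = ∀ K → K ∈ F → c K ∈ K

module _ {nN nT : ℕ} (G : Game nN nT) (A : NFA nT) where
  open Game G
  open NFA A using (nQ)

  rulesOf : Fin nN → List (SF nN nT)
  rulesOf X = map proj₂ (filter (λ r → proj₁ r ≟ X) rules)

  combine : Owner → List (Formula nQ) → Formula nQ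
  combine prover  = ⋀
  combine refuter = ⋁

  mutual
    σ^ : ℕ → Fin nN → Formula nQ
    σ^ zero    X = ff
    σ^ (suc i) X = combine (owner X) (σSF^-list i (rulesOf X))

    σSF^-list : ℕ → List (SF nN nT) → List (Formula nQ)
    σSF^-list i []       = []
    σSF^-list i (η ∷ ηs) = σSF^ i η ∷ σSF^-list i ηs

    σSym^ : ℕ → Sym nN nT → Formula nQ
    σSym^ i (term a) = [ [ ⟦ A ⟧ [ a ] ] ]
    σSym^ i (nt X)   = σ^ i X

    σSF^ : ℕ → SF nN nT → Formula nQ
    σSF^ i []           = [ [ idB ] ]
    σSF^ i (s ∷ [])     = σSym^ i s
    σSF^ i (s ∷ t ∷ α)  = σSym^ i s ⨾F σSF^ i (t ∷ α)

  StabilizesAt : ℕ → Set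
  StabilizesAt i₀ = ∀ j → i₀ ≤ j → ∀ X → σ^ j X ⟺ σ^ i₀ X

Chosen : ∀ {n} → (Clause n → Box n) → Formula n → Box n → Set
Chosen c F ρ = ∃[ K ] (K ∈ F × c K ≡ ρ)

-- A ranking of a sentential form s₁⋯sₘ assigns levels kⱼ ≤ i₀ to its symbols.  It certifies the form for a
-- valuation v of boxes if v satisfies σ^k₁(s₁) ; ⋯ ; σ^kₘ(sₘ) in the alternating reading "for every clause
-- of the first formula some box, then for every clause of the next one some box, …, and v holds of the
-- composed box"; its potential is the sum of base^kⱼ over the non-terminals.  For v(ρ) = "ρ = c(K) for some
-- K ∈ σ(α)", the form α is certified with all levels i₀.  In a certificate of minimal potential the
-- leftmost non-terminal X has a level k+1 (level 0 is false), and σ^(k+1)(X) is the conjunction (prover) or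
-- the disjunction (refuter) of the σ^k(η) over the rules X → η.  So every prover move, and some refuter
-- move, yields a certificate giving the new symbols level k, which lowers the potential since base exceeds
-- the length of every right-hand side.  Refuter plays such a move; hence conforming plays are finite, and a
-- certificate of the final terminal word w yields v([w]).

module Submission where

open import Defs
open import Data.Nat using (ℕ; zero; suc; _+_; _*_; _^_; _≤_; _<_; _<?_; s≤s; z≤n)
open import Data.Nat.Properties
  using (≤-refl; ≤-trans; ≤-<-trans; <⇒≤; ≤-pred; ≤-reflexive; n≤1+n; m≤n+m; <-irrefl; +-suc;
         +-identityʳ; +-monoʳ-≤; +-monoˡ-≤; +-monoʳ-<; +-monoˡ-<; *-monoˡ-<; m^n≢0; module ≤-Reasoning)
open import Data.Nat.ListAction using (sum)
open import Data.Nat.ListAction.Properties using (sum-++)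
open import Data.Fin using (Fin) renaming (_≟_ to _≟Fin_)
open import Data.Bool using (Bool; true; false; T; _∧_) renaming (_≟_ to _≟Bool_)
open import Data.Bool.Properties using (T-∧; T-≡)
open import Data.Empty using (⊥; ⊥-elim)
open import Data.Maybe using (Maybe; just; nothing)
import Data.Maybe as Maybe
open import Data.List
  using (List; []; _∷_; _++_; [_]; map; concat; zipWith; length; deduplicate; filter; upTo; allFin;
         cartesianProductWith)
open import Data.List.Properties using (map-++; ++-identityʳ; map-∘; map-id; ∷-injective)
open import Data.List.Extrema.Nat using (max; xs≤max; argmin; argmin-sel; f[argmin]≤f[⊤]; f[argmin]≤f[xs])
open import Data.List.Relation.Unary.All as All using (All; []; _∷_; all?)
open import Data.List.Relation.Unary.All.Properties
  using (¬All⇒Any¬; ¬Any⇒All¬; All¬⇒¬Any; map⁺; ++⁺; ++⁻)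
open import Data.List.Relation.Unary.Any as Any using (Any; here; there; any?; satisfied)
import Data.List.Relation.Unary.Any.Properties as Any
open import Data.List.Membership.Propositional using (_∈_; find; lose)
open import Data.List.Membership.Propositional.Properties
  using (∈-allFin; ∈-map⁺; ∈-map⁻; ∈-concatMap⁺; ∈-deduplicate⁻; ∈-filter⁺; ∈-filter⁻;
         ∈-upTo⁺; ∈-upTo⁻; ∈-cartesianProductWith⁺; ∈-cartesianProductWith⁻)
open import Data.Vec using (tabulate; lookup)
open import Data.Vec.Properties using (lookup∘tabulate; tabulate∘lookup; tabulate-cong)
open import Data.Product using (Σ; ∃-syntax; _×_; _,_; proj₁; proj₂; uncurry)
open import Data.Sum using (_⊎_; inj₁; inj₂; [_,_]′)
open import Function using (_∘_; id; flip; case_of_; _⇔_; mk⇔; Equivalence)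
open import Relation.Binary.PropositionalEquality
  using (_≡_; refl; sym; trans; cong; cong₂; subst; module ≡-Reasoning)
open import Relation.Nullary using (¬_; Dec; yes; no; contradiction)
open import Relation.Nullary.Decidable using (⌊_⌋; toWitness; fromWitness; map′; _×-dec_)
open import Relation.Unary using (Decidable)

open Equivalence using (to; from)

-- 0 on the empty list; only used on lists with an element.
minBy : ∀ {a} {A : Set a} → (A → ℕ) → List A → ℕ
minBy f []       = 0
minBy f (x ∷ xs) = f (argmin f x xs)

module _ {a} {A : Set a} (f : A → ℕ) where

  minBy-≤ : ∀ {x xs} → x ∈ xs → minBy f xs ≤ f x
  minBy-≤ {xs = x ∷ xs} (here refl) = f[argmin]≤f[⊤] {f = f} x xs
  minBy-≤ {xs = y ∷ xs} (there x∈)  = All.lookup (f[argmin]≤f[xs] {f = f} y xs) x∈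

  minBy-attained : ∀ {x xs} → x ∈ xs → ∃[ y ] (y ∈ xs × f y ≡ minBy f xs)
  minBy-attained {xs = y ∷ xs} _ with argmin-sel f y xs
  ... | inj₁ min≡y = y , here refl , cong f (sym min≡y)
  ... | inj₂ min∈  = _ , there min∈ , refl

no-descending-chain : (g : ℕ → ℕ) → ¬ (∀ i → g (suc i) < g i)
no-descending-chain g descending = <-irrefl refl (≤-trans (m≤n+m _ _) (bound (suc (g 0))))
  where
  bound : ∀ i → g i + i ≤ g 0
  bound zero    = ≤-reflexive (+-identityʳ (g 0))
  bound (suc i) = ≤-trans (≤-reflexive (+-suc (g (suc i)) i))
                    (≤-trans (+-monoˡ-≤ i (descending i)) (bound i))

module _ {a} {A : Set a} {Inv : A → Set} (Φ : A → ℕ) (_↝_ : A → A → Set)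
         (descent : ∀ {x y} → x ↝ y → Inv x → Inv y × Φ y < Φ x) where

  invariant-along : ∀ (f : ℕ → A) n → Inv (f 0) → (∀ i → i < n → f i ↝ f (suc i)) → Inv (f n)
  invariant-along f zero    inv₀ steps = inv₀
  invariant-along f (suc n) inv₀ steps =
    proj₁ (descent (steps n ≤-refl) (invariant-along f n inv₀ λ i i<n → steps i (≤-trans i<n (n≤1+n n))))

  no-infinite-path : ∀ (f : ℕ → A) → Inv (f 0) → ¬ (∀ i → f i ↝ f (suc i))
  no-infinite-path f inv₀ steps = no-descending-chain (Φ ∘ f) λ i →
    proj₂ (descent (steps i) (invariant-along f i inv₀ (λ j _ → steps j)))

module _ {a} {A : Set a} {P : A → Set} (P? : Decidable P) where

  firstOr : A → List A → A
  firstOr d []       = d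
  firstOr d (x ∷ xs) with P? x
  ... | yes _ = x
  ... | no _  = firstOr d xs

  firstOr-satisfies : ∀ d {xs} → Any P xs → P (firstOr d xs)
  firstOr-satisfies d {x ∷ xs} px∷xs with P? x | px∷xs
  ... | yes px | _          = px
  ... | no ¬px | here px    = contradiction px ¬px
  ... | no _   | there pxs  = firstOr-satisfies d pxs

  firstOr-preserves : ∀ {Q : A → Set} {d} xs → Q d → All Q xs → Q (firstOr d xs)
  firstOr-preserves []       qd []         = qd
  firstOr-preserves (x ∷ xs) qd (qx ∷ qxs) with P? x
  ... | yes _ = qx
  ... | no _  = firstOr-preserves xs qd qxs

T-injective : ∀ {x y : Bool} → (T x ⇔ T y) → x ≡ y
T-injective {false} {false} _   = refl
T-injective {false} {true}  x⇔y = ⊥-elim (from x⇔y _)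
T-injective {true}  {false} x⇔y = ⊥-elim (to x⇔y _)
T-injective {true}  {true}  _   = refl

T-existsFin : ∀ {n} (p : Fin n → Bool) → T (existsFin p) ⇔ (∃[ q ] T (p q))
T-existsFin {n} p = mk⇔
  (satisfied ∘ from (Any.any⇔ {xs = allFin n}))
  (λ (q , pq) → to Any.any⇔ (lose (∈-allFin q) pq))

module _ {n : ℕ} where

  ∋-tabulate : ∀ (f : Fin n → Fin n → Bool) q q' →
               (tabulate λ x → tabulate λ y → f x y) ∋⟨ q , q' ⟩ ≡ f q q'
  ∋-tabulate f q q' = trans (cong (λ r → lookup r q') (lookup∘tabulate _ q)) (lookup∘tabulate (f q) q')

  box-ext : ∀ {ρ τ : Box n} → (∀ q q' → T (ρ ∋⟨ q , q' ⟩) ⇔ T (τ ∋⟨ q , q' ⟩)) → ρ ≡ τ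
  box-ext {ρ} {τ} ρ⇔τ = begin
    ρ                    ≡⟨ tabulate∘lookup ρ ⟨
    tabulate (lookup ρ)  ≡⟨ tabulate-cong row ⟩
    tabulate (lookup τ)  ≡⟨ tabulate∘lookup τ ⟩
    τ                    ∎
    where
    open ≡-Reasoning
    row : ∀ q → lookup ρ q ≡ lookup τ q
    row q = trans (sym (tabulate∘lookup _))
              (trans (tabulate-cong (λ q' → T-injective (ρ⇔τ q q'))) (tabulate∘lookup _))

  ∋-⨾ : ∀ (ρ τ : Box n) {q q''} →
        T ((ρ ⨾ τ) ∋⟨ q , q'' ⟩) ⇔ (∃[ q' ] (T (ρ ∋⟨ q , q' ⟩) × T (τ ∋⟨ q' , q'' ⟩)))
  ∋-⨾ ρ τ {q} {q''}
    rewrite ∋-tabulate (λ x z → existsFin λ y → (ρ ∋⟨ x , y ⟩) ∧ (τ ∋⟨ y , z ⟩)) q q'' =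
    mk⇔ (λ h → let (q' , e) = to (T-existsFin _) h in q' , to T-∧ e)
        (λ (q' , e) → from (T-existsFin _) (q' , from T-∧ e))

  ∋-idB : ∀ {q q'} → T (idB {n} ∋⟨ q , q' ⟩) ⇔ q ≡ q'
  ∋-idB {q} {q'} rewrite ∋-tabulate (λ x y → ⌊ x ≟Fin y ⌋) q q' =
    mk⇔ toWitness fromWitness

  ⨾-assoc : ∀ (ρ τ χ : Box n) → (ρ ⨾ τ) ⨾ χ ≡ ρ ⨾ (τ ⨾ χ)
  ⨾-assoc ρ τ χ = box-ext λ q q'' → mk⇔
    (λ h → let (q₂ , ρτ , χ₂) = to (∋-⨾ (ρ ⨾ τ) χ) h ; (q₁ , ρ₁ , τ₁) = to (∋-⨾ ρ τ) ρτ
           in from (∋-⨾ ρ (τ ⨾ χ)) (q₁ , ρ₁ , from (∋-⨾ τ χ) (q₂ , τ₁ , χ₂)))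
    (λ h → let (q₁ , ρ₁ , τχ) = to (∋-⨾ ρ (τ ⨾ χ)) h ; (q₂ , τ₁ , χ₂) = to (∋-⨾ τ χ) τχ
           in from (∋-⨾ (ρ ⨾ τ) χ) (q₂ , from (∋-⨾ ρ τ) (q₁ , ρ₁ , τ₁) , χ₂))

  ⨾-identityˡ : ∀ (ρ : Box n) → idB ⨾ ρ ≡ ρ
  ⨾-identityˡ ρ = box-ext λ q q'' → mk⇔
    (λ h → let (q' , q≡q' , ρ') = to (∋-⨾ idB ρ) h
           in subst (λ x → T (ρ ∋⟨ x , q'' ⟩)) (sym (to ∋-idB q≡q')) ρ')
    (λ h → from (∋-⨾ idB ρ) (q , from ∋-idB refl , h))

  ⨾-identityʳ : ∀ (ρ : Box n) → ρ ⨾ idB ≡ ρ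
  ⨾-identityʳ ρ = box-ext λ q q'' → mk⇔
    (λ h → let (q' , ρ' , q'≡q'') = to (∋-⨾ ρ idB) h
           in subst (λ x → T (ρ ∋⟨ q , x ⟩)) (to ∋-idB q'≡q'') ρ')
    (λ h → from (∋-⨾ ρ idB) (q'' , h , from ∋-idB refl))

module _ {nT : ℕ} (A : NFA nT) where
  open NFA A using () renaming (trans to δ)

  ∋-⟦_⟧ : ∀ w {q q'} → T (⟦ A ⟧ w ∋⟨ q , q' ⟩) ⇔ T (reach A q w q')
  ∋-⟦ w ⟧ {q} {q'} rewrite ∋-tabulate (λ x y → reach A x w y) q q' = mk⇔ id id

  reach-[_] : ∀ a {q q'} → T (reach A q [ a ] q') ⇔ T (δ q a q')
  reach-[ a ] {q} {q'} = mk⇔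
    (λ h → let (q₁ , e) = to (T-existsFin via) h ; (δq , q₁≡q') = to T-∧ e
           in subst (λ x → T (δ q a x)) (toWitness q₁≡q') δq)
    (λ δq → from (T-existsFin via) (q' , from T-∧ (δq , fromWitness refl)))
    where
    via : Fin (NFA.nQ A) → Bool
    via q₁ = δ q a q₁ ∧ reach A q₁ [] q'

  ⟦⟧-∷ : ∀ a w → ⟦ A ⟧ (a ∷ w) ≡ ⟦ A ⟧ [ a ] ⨾ ⟦ A ⟧ w
  ⟦⟧-∷ a w = box-ext λ q q'' → mk⇔
    (λ h → let (q' , e) = to (T-existsFin _) (to ∋-⟦ a ∷ w ⟧ h) ; (δq , r) = to T-∧ e
           in from (∋-⨾ (⟦ A ⟧ [ a ]) (⟦ A ⟧ w))
                (q' , from ∋-⟦ [ a ] ⟧ (from reach-[ a ] δq) , from ∋-⟦ w ⟧ r))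
    (λ h → let (q' , aq , r) = to (∋-⨾ (⟦ A ⟧ [ a ]) (⟦ A ⟧ w)) h
           in from ∋-⟦ a ∷ w ⟧ (from (T-existsFin λ x → δ q a x ∧ reach A x w q'')
                (q' , from T-∧ (to reach-[ a ] (to ∋-⟦ [ a ] ⟧ aq) , to ∋-⟦ w ⟧ r))))

module _ {n : ℕ} where

  Holds : (Box n → Set) → Formula n → Set
  Holds P = All (Any P)

  holds? : ∀ {P : Box n → Set} → Decidable P → Decidable (Holds P)
  holds? P? = all? (any? P?)

  holds-map : ∀ {P Q : Box n → Set} → (∀ {ρ} → P ρ → Q ρ) →
              ∀ {F} → Holds P F → Holds Q F
  holds-map P⇒Q = All.map (Any.map P⇒Q)

  ¬holds-ff : ∀ {P : Box n → Set} → ¬ Holds P ff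
  ¬holds-ff (() ∷ [])

  holds-⋀ : ∀ {P : Box n → Set} Fs → Holds P (⋀ Fs) → All (Holds P) Fs
  holds-⋀ []       _  = []
  holds-⋀ (F ∷ Fs) h  = let (hF , hFs) = ++⁻ F h in hF ∷ holds-⋀ Fs hFs

  holds-∨F : ∀ {P : Box n → Set} → Decidable P → ∀ F H →
             Holds P (F ∨F H) → Holds P F ⊎ Holds P H
  holds-∨F P? F H h with holds? P? F
  ... | yes hF = inj₁ hF
  ... | no ¬hF with find (¬All⇒Any¬ (any? P?) F ¬hF)
  ...   | K , K∈F , ¬PK = inj₂ (All.tabulate λ K'∈H →
            [ flip contradiction ¬PK , id ]′
              (Any.++⁻ K (All.lookup h (∈-concatMap⁺ _ (lose K∈F (∈-map⁺ (K ++_) K'∈H))))))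

  holds-⋁ : ∀ {P : Box n → Set} → Decidable P → ∀ Fs → Holds P (⋁ Fs) → Any (Holds P) Fs
  holds-⋁ P? []       h = contradiction h ¬holds-ff
  holds-⋁ P? (F ∷ Fs) h with holds-∨F P? F (⋁ Fs) h
  ... | inj₁ hF  = here hF
  ... | inj₂ hFs = there (holds-⋁ P? Fs hFs)

  composeClause : List (Box n) → List (Clause n) → Clause n
  composeClause L zs = concat (zipWith (λ ρ K' → map (ρ ⨾_) K') L zs)

  ∈-⨾F : ∀ {F H K zs} → K ∈ F → zs ∈ selections (length (deduplicate _≟B_ K)) H →
         composeClause (deduplicate _≟B_ K) zs ∈ F ⨾F H
  ∈-⨾F K∈F zs∈ = ∈-concatMap⁺ _ (lose K∈F (∈-map⁺ _ zs∈))

  refuting-selection : ∀ {P : Box n → Set} {H} L →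
    All (λ ρ → ∃[ K' ] (K' ∈ H × All (¬_ ∘ P ∘ (ρ ⨾_)) K')) L →
    ∃[ zs ] (zs ∈ selections (length L) H × All (¬_ ∘ P) (composeClause L zs))
  refuting-selection []      []                        = [] , here refl , []
  refuting-selection (ρ ∷ L) ((K' , K'∈H , ¬PK') ∷ rest) =
    let (zs , zs∈ , ¬Pzs) = refuting-selection L rest
    in K' ∷ zs , ∈-concatMap⁺ _ (lose K'∈H (∈-map⁺ (K' ∷_) zs∈)) , ++⁺ (map⁺ ¬PK') ¬Pzs

  -- If no box of K worked, choosing for every ρ ∈ K a clause of H refuting ρ would give a map z : K → H
  -- whose clause of F ; H is refuted.
  holds-⨾F : ∀ {P : Box n → Set} → Decidable P → ∀ F H →
             Holds P (F ⨾F H) → Holds (λ ρ → Holds (P ∘ (ρ ⨾_)) H) F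
  holds-⨾F {P} P? F H h = All.tabulate holds-at
    where
    holds-at : ∀ {K} → K ∈ F → Any (λ ρ → Holds (P ∘ (ρ ⨾_)) H) K
    holds-at {K} K∈F with any? (λ ρ → holds? (P? ∘ (ρ ⨾_)) H) K
    ... | yes hK = hK
    ... | no ¬hK = contradiction (All.lookup h (∈-⨾F K∈F zs∈)) (All¬⇒¬Any ¬Pzs)
      where
      refutation : ∀ {ρ} → ρ ∈ deduplicate _≟B_ K → ∃[ K' ] (K' ∈ H × All (¬_ ∘ P ∘ (ρ ⨾_)) K')
      refutation {ρ} ρ∈ =
        let ¬hρ = ¬hK ∘ lose (∈-deduplicate⁻ _≟B_ K ρ∈)
            (K' , K'∈H , ¬PK') = find (¬All⇒Any¬ (any? (P? ∘ (ρ ⨾_))) H ¬hρ)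
        in K' , K'∈H , ¬Any⇒All¬ K' ¬PK'
      selection = refuting-selection (deduplicate _≟B_ K) (All.tabulate refutation)
      zs∈ = proj₁ (proj₂ selection)
      ¬Pzs = proj₂ (proj₂ selection)

  SatSeq : (Box n → Bool) → List (Formula n) → Set
  SatSeq v []       = v idB ≡ true
  SatSeq v (F ∷ Fs) = Holds (λ ρ → SatSeq (λ x → v (ρ ⨾ x)) Fs) F

  satSeq? : ∀ v Fs → Dec (SatSeq v Fs)
  satSeq? v []       = v idB ≟Bool true
  satSeq? v (F ∷ Fs) = holds? (λ ρ → satSeq? (λ x → v (ρ ⨾ x)) Fs) F

  satSeq-cong : ∀ {v v'} Fs → (∀ x → v x ≡ v' x) → SatSeq v Fs → SatSeq v' Fs
  satSeq-cong []       v≗v' s = trans (sym (v≗v' idB)) s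
  satSeq-cong (F ∷ Fs) v≗v' s = holds-map (satSeq-cong Fs (λ x → v≗v' _)) s

  sat⇒satSeq : ∀ {v} F → Sat v F → SatSeq v [ F ]
  sat⇒satSeq {v} F = holds-map λ {ρ} vρ → trans (cong v (⨾-identityʳ ρ)) vρ

  satSeq-box : ∀ {v} ρ Fs → SatSeq v ([ [ ρ ] ] ∷ Fs) ⇔ SatSeq (λ x → v (ρ ⨾ x)) Fs
  satSeq-box ρ Fs = mk⇔ (λ { (here s ∷ []) → s }) (λ s → here s ∷ [])

  satSeq-⨾F : ∀ {v} F H Fs → SatSeq v (F ⨾F H ∷ Fs) → SatSeq v (F ∷ H ∷ Fs)
  satSeq-⨾F {v} F H Fs s =
    holds-map (λ {ρ} → holds-map λ {τ} → satSeq-cong Fs (λ x → cong v (⨾-assoc ρ τ x)))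
      (holds-⨾F (λ x → satSeq? (λ y → v (x ⨾ y)) Fs) F H s)

module Semantics {nN nT : ℕ} (G : Game nN nT) (A : NFA nT) where
  open Game G
  open NFA A using (nQ)

  σSF^-list≡map : ∀ i ηs → σSF^-list G A i ηs ≡ map (σSF^ G A i) ηs
  σSF^-list≡map i []       = refl
  σSF^-list≡map i (η ∷ ηs) = cong (σSF^ G A i η ∷_) (σSF^-list≡map i ηs)

  ∈-rulesOf⁺ : ∀ {X η} → (X , η) ∈ rules → η ∈ rulesOf G A X
  ∈-rulesOf⁺ {X} X→η = ∈-map⁺ proj₂ (∈-filter⁺ (λ r → proj₁ r ≟Fin X) X→η refl)

  ∈-rulesOf⁻ : ∀ {X η} → η ∈ rulesOf G A X → (X , η) ∈ rules
  ∈-rulesOf⁻ {X} η∈ with ∈-map⁻ proj₂ η∈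
  ... | _ , r∈ , refl with ∈-filter⁻ (λ r → proj₁ r ≟Fin X) {xs = rules} r∈
  ...   | X→η , refl = X→η

  satSeq-σSF : ∀ {v} i β Fs →
               SatSeq v (σSF^ G A i β ∷ Fs) → SatSeq v (map (σSym^ G A i) β ++ Fs)
  satSeq-σSF {v} i []          Fs (here s ∷ []) = satSeq-cong Fs (λ x → cong v (⨾-identityˡ x)) s
  satSeq-σSF     i (s ∷ [])    Fs h = h
  satSeq-σSF {v} i (s ∷ t ∷ β) Fs h =
    holds-map (λ {ρ} → satSeq-σSF {v = λ x → v (ρ ⨾ x)} i (t ∷ β) Fs)
      (satSeq-⨾F {v = v} _ _ Fs h)

  σ^-by-owner : ∀ {o} i X → owner X ≡ o →
                σ^ G A (suc i) X ≡ combine G A o (map (σSF^ G A i) (rulesOf G A X))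
  σ^-by-owner i X refl = cong (combine G A (owner X)) (σSF^-list≡map i (rulesOf G A X))

  letters : List (Fin nT) → List (Formula nQ)
  letters = map λ a → [ [ ⟦ A ⟧ [ a ] ] ]

  satSeq-letters : ∀ {v} w Fs → SatSeq v (letters w ++ Fs) ⇔ SatSeq (λ x → v (⟦ A ⟧ w ⨾ x)) Fs
  satSeq-letters {v} [] Fs = mk⇔
    (satSeq-cong Fs λ x → cong v (sym (⨾-identityˡ x)))
    (satSeq-cong Fs λ x → cong v (⨾-identityˡ x))
  satSeq-letters {v} (a ∷ w) Fs = mk⇔
    (satSeq-cong Fs (λ x → cong v (sym (shift x))) ∘ to (satSeq-letters w Fs)
       ∘ to (satSeq-box {v = v} ρₐ _))
    (from (satSeq-box {v = v} ρₐ _) ∘ from (satSeq-letters w Fs)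
       ∘ satSeq-cong Fs (λ x → cong v (shift x)))
    where
    ρₐ = ⟦ A ⟧ [ a ]
    shift : ∀ x → ⟦ A ⟧ (a ∷ w) ⨾ x ≡ ρₐ ⨾ (⟦ A ⟧ w ⨾ x)
    shift x = trans (cong (_⨾ x) (⟦⟧-∷ A a w)) (⨾-assoc ρₐ (⟦ A ⟧ w) x)

maxRuleLength : ∀ {nN nT} → Game nN nT → ℕ
maxRuleLength G = max 0 (map (length ∘ proj₂) (Game.rules G))

length≤maxRuleLength : ∀ {nN nT} (G : Game nN nT) {X η} →
                       (X , η) ∈ Game.rules G → length η ≤ maxRuleLength G
length≤maxRuleLength G X→η = All.lookup (xs≤max 0 _) (∈-map⁺ (length ∘ proj₂) X→η)

module RankedForms {nN nT : ℕ} (G : Game nN nT) (A : NFA nT) where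
  open Game G
  open NFA A using (nQ)
  open Semantics G A

  RankedForm : Set
  RankedForm = List (ℕ × Sym nN nT)

  erase : RankedForm → SF nN nT
  erase = map proj₂

  formulas : RankedForm → List (Formula nQ)
  formulas = map (uncurry (σSym^ G A))

  atLevel : ℕ → SF nN nT → RankedForm
  atLevel k = map (k ,_)

  erase-atLevel : ∀ k β → erase (atLevel k β) ≡ β
  erase-atLevel k β = trans (sym (map-∘ β)) (map-id β)

  formulas-atLevel : ∀ k β → formulas (atLevel k β) ≡ map (σSym^ G A k) β
  formulas-atLevel k β = sym (map-∘ β)

  formulas-atLevel-++ : ∀ k η r → formulas (atLevel k η ++ r) ≡ map (σSym^ G A k) η ++ formulas r
  formulas-atLevel-++ k η r = trans (map-++ _ (atLevel k η) r) (cong (_++ formulas r) (formulas-atLevel k η))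

  erase-atLevel-++ : ∀ k η r → erase (atLevel k η ++ r) ≡ η ++ erase r
  erase-atLevel-++ k η r = trans (map-++ proj₂ (atLevel k η) r) (cong (_++ erase r) (erase-atLevel k η))

  formulas-terminal : ∀ r w → erase r ≡ terms G w → formulas r ≡ letters w
  formulas-terminal []                  []      _ = refl
  formulas-terminal ((k , term a) ∷ r) (b ∷ w) e with ∷-injective e
  ... | refl , e' = cong (_ ∷_) (formulas-terminal r w e')
  formulas-terminal ((k , nt X) ∷ r)   (b ∷ w) e with ∷-injective e
  ... | () , _

  erase-split : ∀ r w X γ → erase r ≡ terms G w ++ nt X ∷ γ →
    ∃[ r₁ ] ∃[ k ] ∃[ r₂ ]
      (r ≡ r₁ ++ (k , nt X) ∷ r₂ × erase r₁ ≡ terms G w × erase r₂ ≡ γ)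
  erase-split ((k , s) ∷ r) [] X γ e with ∷-injective e
  ... | refl , e' = [] , k , r , refl , refl , e'
  erase-split ((k , s) ∷ r) (a ∷ w) X γ e with ∷-injective e
  ... | refl , e' with erase-split r w X γ e'
  ...   | r₁ , k' , r₂ , refl , e₁ , e₂ =
    (k , term a) ∷ r₁ , k' , r₂ , refl , cong (term a ∷_) e₁ , e₂

  satSeq-after-letters : ∀ {v} r₁ r₂ w → erase r₁ ≡ terms G w →
    SatSeq v (formulas (r₁ ++ r₂)) ⇔ SatSeq (λ x → v (⟦ A ⟧ w ⨾ x)) (formulas r₂)
  satSeq-after-letters {v} r₁ r₂ w e
    rewrite map-++ (uncurry (σSym^ G A)) r₁ r₂ | formulas-terminal r₁ w e = satSeq-letters w (formulas r₂)

  base : ℕ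
  base = suc (maxRuleLength G)

  weight : ℕ × Sym nN nT → ℕ
  weight (k , term _) = 0
  weight (k , nt _)   = base ^ k

  potential : RankedForm → ℕ
  potential = sum ∘ map weight

  potential-++ : ∀ r r' → potential (r ++ r') ≡ potential r + potential r'
  potential-++ r r' = trans (cong sum (map-++ weight r r')) (sum-++ (map weight r) (map weight r'))

  potential-atLevel : ∀ k η → potential (atLevel k η) ≤ length η * base ^ k
  potential-atLevel k []           = z≤n
  potential-atLevel k (term a ∷ η) = ≤-trans (potential-atLevel k η) (m≤n+m _ (base ^ k))
  potential-atLevel k (nt X ∷ η)   = +-monoʳ-≤ (base ^ k) (potential-atLevel k η)

  potential-expansion : ∀ {X η} r₁ r₂ k → (X , η) ∈ rules →
    potential (r₁ ++ atLevel k η ++ r₂) < potential (r₁ ++ (suc k , nt X) ∷ r₂)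
  potential-expansion {X} {η} r₁ r₂ k X→η = begin-strict
    potential (r₁ ++ atLevel k η ++ r₂)
      ≡⟨ trans (potential-++ r₁ _) (cong (potential r₁ +_) (potential-++ (atLevel k η) r₂)) ⟩
    potential r₁ + (potential (atLevel k η) + potential r₂)
      <⟨ +-monoʳ-< (potential r₁) (+-monoˡ-< (potential r₂) atLevel<weight) ⟩
    potential r₁ + (base ^ suc k + potential r₂)
      ≡⟨ potential-++ r₁ _ ⟨
    potential (r₁ ++ (suc k , nt X) ∷ r₂) ∎
    where
    open ≤-Reasoning
    atLevel<weight : potential (atLevel k η) < base ^ suc k
    atLevel<weight = ≤-<-trans (potential-atLevel k η)
      (*-monoˡ-< (base ^ k) {{m^n≢0 base k}} (s≤s (length≤maxRuleLength G X→η)))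

module Certificates {nN nT : ℕ} (G : Game nN nT) (A : NFA nT) (i₀ : ℕ)
                    (v : Box (NFA.nQ A) → Bool) where
  open Semantics G A
  open RankedForms G A

  Bounded : RankedForm → Set
  Bounded = All ((_≤ i₀) ∘ proj₁)

  record _Certifies_ (r : RankedForm) (β : SF nN nT) : Set where
    field
      erases  : erase r ≡ β
      bounded : Bounded r
      holds   : SatSeq v (formulas r)

  Certified : SF nN nT → Set
  Certified β = ∃[ r ] (r Certifies β)

  rankings : SF nN nT → List RankedForm
  rankings []      = [ [] ]
  rankings (s ∷ β) = cartesianProductWith (λ k r → (k , s) ∷ r) (upTo (suc i₀)) (rankings β)

  ∈-rankings⁺ : ∀ {r} → Bounded r → r ∈ rankings (erase r)
  ∈-rankings⁺ []                   = here refl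
  ∈-rankings⁺ {(k , s) ∷ r} (k≤i₀ ∷ b) =
    ∈-cartesianProductWith⁺ (λ k r → (k , s) ∷ r) (∈-upTo⁺ (s≤s k≤i₀)) (∈-rankings⁺ b)

  ∈-rankings⁻ : ∀ {r} β → r ∈ rankings β → erase r ≡ β × Bounded r
  ∈-rankings⁻ []      (here refl) = refl , []
  ∈-rankings⁻ (s ∷ β) r∈
    with ∈-cartesianProductWith⁻ (λ k r → (k , s) ∷ r) (upTo (suc i₀)) (rankings β) r∈
  ... | k , r , k∈ , r∈' , refl =
    let (e , b) = ∈-rankings⁻ β r∈' in cong (s ∷_) e , ≤-pred (∈-upTo⁻ k∈) ∷ b

  certificates : SF nN nT → List RankedForm
  certificates β = filter (satSeq? v ∘ formulas) (rankings β)

  ∈-certificates⁺ : ∀ {r β} → r Certifies β → r ∈ certificates β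
  ∈-certificates⁺ {r} c =
    ∈-filter⁺ (satSeq? v ∘ formulas) (subst (λ β → r ∈ rankings β) erases (∈-rankings⁺ bounded)) holds
    where open _Certifies_ c

  ∈-certificates⁻ : ∀ {r} β → r ∈ certificates β → r Certifies β
  ∈-certificates⁻ β r∈ =
    let (r∈rankings , h) = ∈-filter⁻ (satSeq? v ∘ formulas) {xs = rankings β} r∈
        (e , b) = ∈-rankings⁻ β r∈rankings
    in record { erases = e ; bounded = b ; holds = h }

  certified? : Decidable Certified
  certified? β with certificates β in eq
  ... | []    = no λ (r , c) → case subst (r ∈_) eq (∈-certificates⁺ c) of λ ()
  ... | r ∷ _ = yes (r , ∈-certificates⁻ β (subst (r ∈_) (sym eq) (here refl)))

  minPotential : SF nN nT → ℕ
  minPotential β = minBy potential (certificates β)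

  minPotential-≤ : ∀ {r β} → r Certifies β → minPotential β ≤ potential r
  minPotential-≤ c = minBy-≤ potential (∈-certificates⁺ c)

  minPotential-attained : ∀ {β} → Certified β →
                          ∃[ r ] (r Certifies β × potential r ≡ minPotential β)
  minPotential-attained {β} (_ , c) =
    let (r , r∈ , e) = minBy-attained potential (∈-certificates⁺ c)
    in r , ∈-certificates⁻ β r∈ , e

  certified-initial : ∀ α → Sat v (σSF^ G A i₀ α) → Certified α
  certified-initial α sat = atLevel i₀ α , record
    { erases  = erase-atLevel i₀ α
    ; bounded = map⁺ (All.tabulate λ _ → ≤-refl)
    ; holds   = subst (SatSeq v) (trans (++-identityʳ _) (sym (formulas-atLevel i₀ α)))
                  (satSeq-σSF i₀ α [] (sat⇒satSeq _ sat)) }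

  certified-terminal : ∀ w → Certified (terms G w) → v (⟦ A ⟧ w) ≡ true
  certified-terminal w (r , c) =
    trans (cong v (sym (⨾-identityʳ _)))
      (to (satSeq-after-letters r [] w erases) (subst (SatSeq v ∘ formulas) (sym (++-identityʳ r)) holds))
    where open _Certifies_ c

module RefuterStrategy {nN nT : ℕ} (G : Game nN nT) (hasRule : EveryNTHasRule G)
                       (A : NFA nT) (i₀ : ℕ) (v : Box (NFA.nQ A) → Bool) where
  open Game G
  open Semantics G A
  open RankedForms G A
  open Certificates G A i₀ v

  Improves : SF nN nT → SF nN nT → Set
  Improves β β' = Certified β' × minPotential β' < minPotential β

  improves? : ∀ β β' → Dec (Improves β β')
  improves? β β' = certified? β' ×-dec (minPotential β' <? minPotential β)

  -- The level at the leftmost non-terminal is a successor because σ^0 = false.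
  record Focus (w : List (Fin nT)) (X : Fin nN) (γ : SF nN nT) : Set where
    field
      prefix suffix : RankedForm
      level         : ℕ
      certifies     : (prefix ++ (suc level , nt X) ∷ suffix) Certifies (terms G w ++ nt X ∷ γ)
      minimal       : potential (prefix ++ (suc level , nt X) ∷ suffix)
                        ≡ minPotential (terms G w ++ nt X ∷ γ)
      prefix-erases : erase prefix ≡ terms G w
      suffix-erases : erase suffix ≡ γ
      focused       : SatSeq (λ x → v (⟦ A ⟧ w ⨾ x)) (σ^ G A (suc level) X ∷ formulas suffix)

  focus : ∀ w X γ → Certified (terms G w ++ nt X ∷ γ) → Focus w X γ
  focus w X γ cert with minPotential-attained cert
  ... | r , c , minimal with erase-split r w X γ (_Certifies_.erases c)
  ...   | r₁ , k , r₂ , refl , e₁ , e₂ = at-level k c minimal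
    where
    at-level : ∀ k → (r₁ ++ (k , nt X) ∷ r₂) Certifies (terms G w ++ nt X ∷ γ) →
               potential (r₁ ++ (k , nt X) ∷ r₂) ≡ minPotential (terms G w ++ nt X ∷ γ) →
               Focus w X γ
    at-level zero     c _       = ⊥-elim (¬holds-ff (to (satSeq-after-letters r₁ _ w e₁) (_Certifies_.holds c)))
    at-level (suc k') c minimal = record
      { prefix = r₁ ; suffix = r₂ ; level = k' ; certifies = c ; minimal = minimal
      ; prefix-erases = e₁ ; suffix-erases = e₂
      ; focused = to (satSeq-after-letters r₁ _ w e₁) (_Certifies_.holds c) }

  expansion-improves : ∀ {w X γ η} (f : Focus w X γ) → (X , η) ∈ rules →
    SatSeq (λ x → v (⟦ A ⟧ w ⨾ x)) (σSF^ G A (Focus.level f) η ∷ formulas (Focus.suffix f)) →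
    Improves (terms G w ++ nt X ∷ γ) (terms G w ++ η ++ γ)
  expansion-improves {w} {X} {γ} {η} f X→η h =
    (expanded , certifies′) ,
    ≤-<-trans (minPotential-≤ certifies′)
      (subst (potential expanded <_) minimal (potential-expansion prefix suffix level X→η))
    where
    open Focus f
    open _Certifies_ certifies
    expanded = prefix ++ atLevel level η ++ suffix
    bounded′ : Bounded expanded
    bounded′ with ++⁻ prefix bounded
    ... | bounded-prefix , level<i₀ ∷ bounded-suffix =
      ++⁺ bounded-prefix (++⁺ (map⁺ (All.tabulate λ _ → <⇒≤ level<i₀)) bounded-suffix)
    certifies′ : expanded Certifies (terms G w ++ η ++ γ)
    certifies′ = record
      { erases  = trans (map-++ proj₂ prefix _)
                    (cong₂ _++_ prefix-erases
                       (trans (erase-atLevel-++ level η suffix) (cong (η ++_) suffix-erases)))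
      ; bounded = bounded′
      ; holds   = from (satSeq-after-letters prefix _ w prefix-erases)
                    (subst (SatSeq _) (sym (formulas-atLevel-++ level η suffix)) (satSeq-σSF level η _ h)) }

  prover-improves : ∀ {w X γ η} → owner X ≡ prover → (X , η) ∈ rules →
    Certified (terms G w ++ nt X ∷ γ) → Improves (terms G w ++ nt X ∷ γ) (terms G w ++ η ++ γ)
  prover-improves {w} {X} {γ} owned X→η cert =
    expansion-improves f X→η (All.lookup (holds-⋀ _ conjunction) (∈-map⁺ _ (∈-rulesOf⁺ X→η)))
    where
    f = focus w X γ cert
    open Focus f
    conjunction = subst (Holds _) (σ^-by-owner level X owned) focused

  refuter-can-improve : ∀ {w X γ} → owner X ≡ refuter → Certified (terms G w ++ nt X ∷ γ) →
    Any (λ η → Improves (terms G w ++ nt X ∷ γ) (terms G w ++ η ++ γ)) (rulesOf G A X)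
  refuter-can-improve {w} {X} {γ} owned cert
    with find (Any.map⁻ (holds-⋁ P? _ (subst (Holds P) (σ^-by-owner level X owned) focused)))
    where
    open Focus (focus w X γ cert)
    P  = λ ρ → SatSeq (λ x → v (⟦ A ⟧ w ⨾ (ρ ⨾ x))) (formulas suffix)
    P? = λ ρ → satSeq? (λ x → v (⟦ A ⟧ w ⨾ (ρ ⨾ x))) (formulas suffix)
  ... | η , η∈ , h = lose η∈ (expansion-improves (focus w X γ cert) (∈-rulesOf⁻ η∈) h)

  leftmost : SF nN nT → Maybe (List (Fin nT) × Fin nN × SF nN nT)
  leftmost []           = nothing
  leftmost (term a ∷ β) = Maybe.map (λ (w , X , γ) → a ∷ w , X , γ) (leftmost β)
  leftmost (nt X ∷ γ)   = just ([] , X , γ)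

  leftmost-terms : ∀ w X γ → leftmost (terms G w ++ nt X ∷ γ) ≡ just (w , X , γ)
  leftmost-terms []      X γ = refl
  leftmost-terms (a ∷ w) X γ rewrite leftmost-terms w X γ = refl

  chosenRule : List (Fin nT) → Fin nN → SF nN nT → SF nN nT
  chosenRule w X γ = firstOr (λ η → improves? (terms G w ++ nt X ∷ γ) (terms G w ++ η ++ γ))
                             (proj₁ (hasRule X)) (rulesOf G A X)

  chosenRule-∈ : ∀ w X γ → (X , chosenRule w X γ) ∈ rules
  chosenRule-∈ w X γ = firstOr-preserves _ (rulesOf G A X) (proj₂ (hasRule X)) (All.tabulate ∈-rulesOf⁻)

  respond : SF nN nT → SF nN nT
  respond β with leftmost β
  ... | nothing          = β
  ... | just (w , X , γ) = terms G w ++ chosenRule w X γ ++ γ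

  respond-terms : ∀ w X γ → respond (terms G w ++ nt X ∷ γ) ≡ terms G w ++ chosenRule w X γ ++ γ
  respond-terms w X γ rewrite leftmost-terms w X γ = refl

  respond-valid : ∀ β → RefPos G β → _⇒L_ G β (respond β)
  respond-valid _ (w , X , γ , refl , _) rewrite respond-terms w X γ = step w X _ γ (chosenRule-∈ w X γ)

  strategy : Strategy G
  strategy = record { move = λ _ → respond ; valid = λ _ β _ → respond-valid β }

  Conforming : SF nN nT → SF nN nT → Set
  Conforming β β' = _⇒L_ G β β' × (RefPos G β → β' ≡ respond β)

  descent : ∀ {β β'} → Conforming β β' → Certified β → Improves β β'
  descent (step w X η γ X→η , conforms) cert with owner X in owned
  ... | prover  = prover-improves owned X→η cert
  ... | refuter = subst (Improves (terms G w ++ nt X ∷ γ)) (sym responded)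
                    (firstOr-satisfies _ _ (refuter-can-improve owned cert))
    where
    responded : terms G w ++ η ++ γ ≡ terms G w ++ chosenRule w X γ ++ γ
    responded = trans (conforms (w , X , γ , refl , owned)) (respond-terms w X γ)

module _ {n : ℕ} (c : Clause n → Box n) (F : Formula n) where

  chosen? : Decidable (Chosen c F)
  chosen? ρ = map′ find (λ (K , K∈ , cK≡ρ) → lose K∈ cK≡ρ) (any? (λ K → c K ≟B ρ) F)

  isChosen : Box n → Bool
  isChosen ρ = ⌊ chosen? ρ ⌋

  sat-isChosen : IsChoice c F → Sat isChosen F
  sat-isChosen isChoice = All.tabulate λ K∈ →
    lose (isChoice _ K∈) (to T-≡ (fromWitness (_ , K∈ , refl)))

  isChosen⇒Chosen : ∀ ρ → isChosen ρ ≡ true → Chosen c F ρ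
  isChosen⇒Chosen ρ = toWitness ∘ from T-≡

proposition28 : ∀ {nN nT : ℕ} (G : Game nN nT) → EveryNTHasRule G →
    (A : NFA nT) → (i₀ : ℕ) → StabilizesAt G A i₀ →
    (α : SF nN nT) →
    (c : Clause (NFA.nQ A) → Box (NFA.nQ A)) → IsChoice c (σSF^ G A i₀ α) →
    Σ (Strategy G) λ s →
      ((n : ℕ) (f : ℕ → SF nN nT) (w : List (Fin nT)) →
        f 0 ≡ α →
        (∀ i → i < n → _⇒L_ G (f i) (f (suc i))) →
        (∀ i → i < n → ConformsAt G s f i) →
        f n ≡ terms G w →
        Chosen c (σSF^ G A i₀ α) (⟦ A ⟧ w))
      ×
      ((f : ℕ → SF nN nT) →
        f 0 ≡ α →
        (∀ i → _⇒L_ G (f i) (f (suc i))) →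
        (∀ i → ConformsAt G s f i) →
        ⊥)
-- The stabilization hypothesis is unused: the statement refers to σ^i₀ itself, and the argument works
-- at every i₀.
proposition28 G hasRule A i₀ _ α c isChoice =
  strategy ,
  (λ n f w f₀≡α steps conforms fₙ≡w →
     let certified-end = invariant-along minPotential Conforming descent f n (start f₀≡α)
                           λ i i<n → steps i i<n , conforms i i<n
     in isChosen⇒Chosen c Φ (⟦ A ⟧ w) (certified-terminal w (subst Certified fₙ≡w certified-end))) ,
  (λ f f₀≡α steps conforms →
     no-infinite-path minPotential Conforming descent f (start f₀≡α) λ i → steps i , conforms i)
  where
  Φ = σSF^ G A i₀ α
  open Certificates G A i₀ (isChosen c Φ)
  open RefuterStrategy G hasRule A i₀ (isChosen c Φ)
  start : ∀ {β} → β ≡ α → Certified β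
  start refl = certified-initial α (sat-isChosen c Φ isChoice)
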